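{- Let $G=(V,E)$ be a strongly connected directed graph and let $v\in V$. Let $K(v)$ be the set of children of the root $v$ in the dominator tree $DT(v)$ of the flowgraph $G(v)$, and let $K^{R}(v)$ be the set of children of the root $v$ in the dominator tree $DT^{R}(v)$ of the flowgraph $G^{R}(v)$. Then every $2$-vertex-connected component $C$ of $G$ with $v\in C$ satisfies $C\subseteq (K(v)\cap K^{R}(v))\cup\{v\}$.
   Context: For a directed graph $G=(V,E)$ and $U\subseteq V$, $G[U]$ is the induced subgraph. $G$ is $2$-vertex-connected if it has at least $3$ vertices and $G[V\setminus X]$ is strongly connected for every $X\subset V$ with $|X|<2$; the $2$-vertex-connected components of $G$ are its maximal $2$-vertex-connected subgraphs (identified with vertex sets $C$, subgraph $G[C]$). The flowgraph $G(v)$ is $G$ with start vertex $v$ (every vertex reachable from $v$). A vertex $w$ dominates $u$ in $G(v)$ if every path from $v$ to $u$ contains $w$. Every $u\neq v$ has a unique immediate dominator $\mathrm{imd}(u)$: a dominator of $u$ different from $u$ that is dominated by all other dominators of $u$ different from $u$. The edges $(\mathrm{imd}(u),u)$ form the dominator tree $DT(v)$ rooted at $v$. The reversal graph $G^{R}=(V,E^{R})$ has $E^{R}=\{(w,u):(u,w)\in E\}$, and $G^{R}(v)$ is the flowgraph of $G^{R}$ with start $v$. -}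

module Defs where

open import Level using (0ℓ)
open import Data.Nat using (ℕ)
open import Data.Fin using (Fin)
open import Data.Product using (Σ; _×_; ∃; ∃-syntax)
open import Data.Sum using (_⊎_)
open import Relation.Nullary using (¬_)
open import Relation.Unary using (Pred; _∈_; _⊆_)
open import Relation.Binary.PropositionalEquality using (_≡_; _≢_)

Graph : ℕ → Set₁
Graph n = Fin n → Fin n → Set

module _ {n : ℕ} where

  rev : Graph n → Graph n
  rev E x y = E y x

  data Walk (E : Graph n) : Fin n → Fin n → Set where
    [] : ∀ {x} → Walk E x x
    _∷_ : ∀ {x y z} → E x y → Walk E y z → Walk E x z

  data _∈W_ {E : Graph n} (w : Fin n) : ∀ {x y} → Walk E x y → Set where
    here-end : ∀ {x} → w ≡ x → w ∈W ([] {x = x})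
    here : ∀ {x y z} {e : E x y} {p : Walk E y z} → w ≡ x → w ∈W (e ∷ p)
    there : ∀ {x y z} {e : E x y} {p : Walk E y z} → w ∈W p → w ∈W (e ∷ p)

  -- all vertices of a walk lie in U (i.e. the walk is a walk of G[U])
  AllIn : {E : Graph n} → Pred (Fin n) 0ℓ → ∀ {x y} → Walk E x y → Set
  AllIn U p = ∀ w → w ∈W p → w ∈ U

  StronglyConnectedOn : Graph n → Pred (Fin n) 0ℓ → Set
  StronglyConnectedOn E U =
    ∀ x y → x ∈ U → y ∈ U → Σ (Walk E x y) (AllIn U)

  _∖₁_ : Pred (Fin n) 0ℓ → Fin n → Pred (Fin n) 0ℓ
  (U ∖₁ x) y = y ∈ U × y ≢ x

  -- G[C] is 2-vertex-connected: at least 3 vertices, and G[C ∖ X] strongly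
  -- connected for every X ⊂ C with |X| < 2 (X = ∅ or X = {x}, x ∈ C).
  TwoVertexConnected : Graph n → Pred (Fin n) 0ℓ → Set
  TwoVertexConnected E C =
    (∃[ a ] ∃[ b ] ∃[ c ] (a ∈ C × b ∈ C × c ∈ C × a ≢ b × a ≢ c × b ≢ c))
    × StronglyConnectedOn E C
    × (∀ x → x ∈ C → StronglyConnectedOn E (C ∖₁ x))

  TwoVCC : Graph n → Pred (Fin n) 0ℓ → Set₁
  TwoVCC E C = TwoVertexConnected E C
             × (∀ (D : Pred (Fin n) 0ℓ) → C ⊆ D → TwoVertexConnected E D → D ⊆ C)

  Dominates : Graph n → Fin n → Fin n → Fin n → Set
  Dominates E v w u = (p : Walk E v u) → w ∈W p

  IsImd : Graph n → Fin n → Fin n → Fin n → Set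
  IsImd E v w u = Dominates E v w u × w ≢ u
                × (∀ x → Dominates E v x u → x ≢ u → Dominates E v x w)

  RootChild : Graph n → Fin n → Fin n → Set
  RootChild E v u = u ≢ v × IsImd E v v u

  StronglyConnected : Graph n → Set
  StronglyConnected E = ∀ x y → Walk E x y

module Submission where

-- Let C be a 2-vertex-connected component containing v and let
-- u ∈ C with u ≠ v.  In the flowgraph G(v) the start vertex v dominates
-- every vertex.  Conversely, any dominator x of u lies on a walk from v to u
-- inside G[C], so x ∈ C; and if x ∉ {v, u}, then G[C ∖ {x}] is strongly
-- connected and contains a walk from v to u avoiding x, a contradiction.
-- Hence the only dominators of u are v and u itself, so v = imd(u) and u is
-- a child of the root in DT(v).  Since walks reverse, G^R[C] is
-- 2-vertex-connected as well, and the same argument applied to G^R gives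
-- u ∈ K^R(v).

open import Defs
open import Data.Nat using (ℕ)
open import Data.Fin using (Fin; _≟_)
open import Data.Product using (_×_; _,_; proj₂)
open import Data.Empty using (⊥-elim)
open import Data.Sum using (_⊎_; inj₁; inj₂)
open import Relation.Nullary using (yes; no)
open import Relation.Unary using (Pred; _∈_)
open import Relation.Binary.PropositionalEquality using (_≡_; _≢_; refl; sym)

module _ {n : ℕ} where

  snoc : ∀ {E : Graph n} {x y z} → Walk E x y → E y z → Walk E x z
  snoc []      e = e ∷ []
  snoc (f ∷ p) e = f ∷ snoc p e

  ∈W-snoc : ∀ {E : Graph n} {x y z w} (p : Walk E x y) (e : E y z) →
            w ∈W snoc p e → w ∈W p ⊎ w ≡ z
  ∈W-snoc []      e (here eq)              = inj₁ (here-end eq)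
  ∈W-snoc []      e (there (here-end eq))  = inj₂ eq
  ∈W-snoc (f ∷ p) e (here eq)              = inj₁ (here eq)
  ∈W-snoc (f ∷ p) e (there w∈)             with ∈W-snoc p e w∈
  ... | inj₁ w∈p = inj₁ (there w∈p)
  ... | inj₂ eq  = inj₂ eq

  reverse : ∀ {E : Graph n} {x y} → Walk E x y → Walk (rev E) y x
  reverse []      = []
  reverse (e ∷ p) = snoc (reverse p) e

  ∈W-reverse : ∀ {E : Graph n} {x y w} (p : Walk E x y) → w ∈W reverse p → w ∈W p
  ∈W-reverse []      (here-end eq) = here-end eq
  ∈W-reverse (e ∷ p) w∈            with ∈W-snoc (reverse p) e w∈
  ... | inj₁ w∈p = there (∈W-reverse p w∈p)
  ... | inj₂ eq  = here eq

  rev-stronglyConnectedOn : {E : Graph n} {U : Pred (Fin n) _} →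
                            StronglyConnectedOn E U → StronglyConnectedOn (rev E) U
  rev-stronglyConnectedOn sc x y x∈U y∈U with sc y x y∈U x∈U
  ... | p , p⊆U = reverse p , λ w w∈ → p⊆U w (∈W-reverse p w∈)

  rev-twoVertexConnected : {E : Graph n} {C : Pred (Fin n) _} →
                           TwoVertexConnected E C → TwoVertexConnected (rev E) C
  rev-twoVertexConnected (three , sc , sc∖) =
    three , rev-stronglyConnectedOn sc , λ x x∈C → rev-stronglyConnectedOn (sc∖ x x∈C)

module _ {n : ℕ} (E : Graph n) where

  start-dominates : ∀ v u → Dominates E v v u
  start-dominates v u []      = here-end refl
  start-dominates v u (e ∷ p) = here refl

  dominator-trivial : ∀ {C} → TwoVertexConnected E C → ∀ {v u x} → v ∈ C → u ∈ C →
                      Dominates E v x u → x ≡ v ⊎ x ≡ u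
  dominator-trivial {C} (_ , sc , sc∖) {v} {u} {x} v∈C u∈C x-dom with x ≟ v | x ≟ u
  ... | yes x≡v | _       = inj₁ x≡v
  ... | no _    | yes x≡u = inj₂ x≡u
  ... | no x≢v  | no x≢u  = ⊥-elim (proj₂ avoiding refl)
    where
    -- x lies on a walk from v to u inside C, hence x ∈ C ...
    x∈C : x ∈ C
    x∈C with sc v u v∈C u∈C
    ... | p , p⊆C = p⊆C x (x-dom p)
    -- ... and a walk from v to u inside G[C ∖ {x}] would still visit x,
    -- giving the absurd x ∈ C ∖ {x}.
    avoiding : x ∈ C ∖₁ x
    avoiding with sc∖ x x∈C v u (v∈C , λ v≡x → x≢v (sym v≡x))
                                      (u∈C , λ u≡x → x≢u (sym u≡x))
    ... | p , p⊆C∖x = p⊆C∖x x (x-dom p)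

  rootChild : ∀ {C} → TwoVertexConnected E C → ∀ {v u} → v ∈ C → u ∈ C → u ≢ v →
              RootChild E v u
  rootChild 2vc {v} {u} v∈C u∈C u≢v =
    u≢v , start-dominates v u , (λ v≡u → u≢v (sym v≡u)) , imd
    where
    imd : ∀ x → Dominates E v x u → x ≢ u → Dominates E v x v
    imd x x-dom x≢u with dominator-trivial 2vc v∈C u∈C x-dom
    ... | inj₁ refl = start-dominates v v
    ... | inj₂ x≡u  = ⊥-elim (x≢u x≡u)

lemma1 : ∀ {n : ℕ} (E : Graph n) → StronglyConnected E → (v : Fin n)
       → ∀ C → TwoVCC E C → v ∈ C
       → ∀ u → u ∈ C → (RootChild E v u × RootChild (rev E) v u) ⊎ u ≡ v
lemma1 E _ v C (2vc , _) v∈C u u∈C with u ≟ v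
... | yes u≡v = inj₂ u≡v
... | no u≢v  = inj₁ ( rootChild E 2vc v∈C u∈C u≢v
                     , rootChild (rev E) (rev-twoVertexConnected 2vc) v∈C u∈C u≢v )
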